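{- Let $m\ge5$ be odd. Let $Y=(x,y,B,0,z)\in A_m$ with $B\ne0$, and suppose $Y\notin\Sigma$. Then $G^m(Y)=(x',y',B,0,z')$, where \[ (x',z')=\Theta(x,z):=\begin{cases}(x-1,0),&z=-1,\\ (-1,0),&x=0,\ z=0,\\ (x-2,z+1),&\text{otherwise},\end{cases} \] and $y'=y$ in the first case, while $y'=y+1$ in the other two cases.
   Context: Indices in $\mathbb Z_5=\{0,\dots,4\}$. $A_m=\{w\in(\mathbb Z_m)^5:\sum_i w_i=0\}$; $e_i$ standard basis vectors; $q_i=e_i-e_4$ ($i=0,1,2,3$), $q_4=0$. For $w\in A_m$, $Z(w)=\{i:w_i=0\}$. The selector $p$ on zero-sets is: $p(\varnothing)=0$; $p(\{0\})=p(\{1\})=p(\{2\})=0$, $p(\{3\})=4$, $p(\{4\})=1$; $p(\{0,1\})=0$, $p(\{0,2\})=0$, $p(\{0,3\})=2$, $p(\{0,4\})=1$, $p(\{1,2\})=4$, $p(\{1,3\})=4$, $p(\{1,4\})=1$, $p(\{2,3\})=1$, $p(\{2,4\})=3$, $p(\{3,4\})=4$; $p(\{0,1,2\})=4$, $p(\{0,1,3\})=2$, $p(\{0,1,4\})=1$, $p(\{0,2,3\})=2$, $p(\{0,2,4\})=3$, $p(\{0,3,4\})=1$, $p(\{1,2,3\})=1$, $p(\{1,2,4\})=4$, $p(\{1,3,4\})=4$, $p(\{2,3,4\})=3$; $p(\{0,1,2,3,4\})=0$ (no point of $A_m$ has a four-element zero-set). $G:A_m\to A_m$ is $G(w)=w-3q_0+q_3+q_{p(Z(w))}=w+(-3,0,0,1,1)+e_{p(Z(w))}$.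 The section is $\Sigma=\{w\in A_m:p(Z(w))=2\}=\{(0,a,b,0,-a-b):a+b\ne0\}$. -}

module Defs where

open import Data.Nat using (ℕ; zero; suc; NonZero; _∸_)
import Data.Nat as ℕ
open import Data.Nat.DivMod using (_%_; m%n<n)
open import Data.Fin using (Fin; toℕ; fromℕ<) renaming (zero to f0; suc to fs)
open import Data.Bool using (Bool; true; false; if_then_else_; _∧_)
import Data.Vec
open import Data.Vec using (Vec; []; _∷_; lookup; tabulate; map)
open import Data.Product using (_×_; _,_; ∃-syntax)
open import Relation.Binary.PropositionalEquality using (_≡_)
open import Relation.Nullary using (¬_)
open import Data.Fin using (_≟_)
open import Relation.Nullary.Decidable using (does)

ℤ_ : (m : ℕ) → Set
ℤ m = Fin m

module _ {m : ℕ} .{{_ : NonZero m}} where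

  mod : ℕ → Fin m
  mod n = fromℕ< (m%n<n n m)

  _+m_ : Fin m → Fin m → Fin m
  a +m b = mod (toℕ a ℕ.+ toℕ b)

  -m_ : Fin m → Fin m
  -m a = mod (m ∸ toℕ a)

  0m : Fin m
  0m = mod 0

  1m : Fin m
  1m = mod 1

  neg : ℕ → Fin m
  neg k = -m (mod k)

Pt : ℕ → Set
Pt m = Vec (Fin m) 5

sum5 : {m : ℕ} .{{_ : NonZero m}} → Pt m → Fin m
sum5 (a ∷ b ∷ c ∷ d ∷ e ∷ []) = a +m (b +m (c +m (d +m e)))

InA : {m : ℕ} .{{_ : NonZero m}} → Pt m → Set
InA w = sum5 w ≡ 0m

Z : {m : ℕ} .{{_ : NonZero m}} → Pt m → Vec Bool 5
Z w = map (λ a → does (a ≟ 0m)) w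

-- the selector p on zero-sets; (b0,b1,b2,b3,b4) with bi = (i ∈ Z).
-- Four-element zero-sets never occur on A_m; they are mapped to 0 arbitrarily.
i0 i1 i2 i3 i4 : Fin 5
i0 = f0
i1 = fs f0
i2 = fs (fs f0)
i3 = fs (fs (fs f0))
i4 = fs (fs (fs (fs f0)))

p : Vec Bool 5 → Fin 5
p (false ∷ false ∷ false ∷ false ∷ false ∷ []) = i0
p (true ∷ false ∷ false ∷ false ∷ false ∷ []) = i0
p (false ∷ true ∷ false ∷ false ∷ false ∷ []) = i0
p (false ∷ false ∷ true ∷ false ∷ false ∷ []) = i0
p (false ∷ false ∷ false ∷ true ∷ false ∷ []) = i4
p (false ∷ false ∷ false ∷ false ∷ true ∷ []) = i1
p (true ∷ true ∷ false ∷ false ∷ false ∷ []) = i0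
p (true ∷ false ∷ true ∷ false ∷ false ∷ []) = i0
p (true ∷ false ∷ false ∷ true ∷ false ∷ []) = i2
p (true ∷ false ∷ false ∷ false ∷ true ∷ []) = i1
p (false ∷ true ∷ true ∷ false ∷ false ∷ []) = i4
p (false ∷ true ∷ false ∷ true ∷ false ∷ []) = i4
p (false ∷ true ∷ false ∷ false ∷ true ∷ []) = i1
p (false ∷ false ∷ true ∷ true ∷ false ∷ []) = i1
p (false ∷ false ∷ true ∷ false ∷ true ∷ []) = i3
p (false ∷ false ∷ false ∷ true ∷ true ∷ []) = i4
p (true ∷ true ∷ true ∷ false ∷ false ∷ []) = i4
p (true ∷ true ∷ false ∷ true ∷ false ∷ []) = i2
p (true ∷ true ∷ false ∷ false ∷ true ∷ []) = i1
p (true ∷ false ∷ true ∷ true ∷ false ∷ []) = i2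
p (true ∷ false ∷ true ∷ false ∷ true ∷ []) = i3
p (true ∷ false ∷ false ∷ true ∷ true ∷ []) = i1
p (false ∷ true ∷ true ∷ true ∷ false ∷ []) = i1
p (false ∷ true ∷ true ∷ false ∷ true ∷ []) = i4
p (false ∷ true ∷ false ∷ true ∷ true ∷ []) = i4
p (false ∷ false ∷ true ∷ true ∷ true ∷ []) = i3
p (true ∷ true ∷ true ∷ true ∷ true ∷ []) = i0
p _ = i0

e : {m : ℕ} .{{_ : NonZero m}} → Fin 5 → Pt m
e i = tabulate (λ j → if does (j ≟ i) then 1m else 0m)

_⊕_ : {m : ℕ} .{{_ : NonZero m}} → Pt m → Pt m → Pt m
v ⊕ w = Data.Vec.zipWith _+m_ v w

shiftG : {m : ℕ} .{{_ : NonZero m}} → Pt m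
shiftG = neg 3 ∷ 0m ∷ 0m ∷ 1m ∷ 1m ∷ []

G : {m : ℕ} .{{_ : NonZero m}} → Pt m → Pt m
G w = (w ⊕ shiftG) ⊕ e (p (Z w))

iter : {A : Set} → ℕ → (A → A) → A → A
iter zero f x = x
iter (suc n) f x = f (iter n f x)

InΣ : {m : ℕ} .{{_ : NonZero m}} → Pt m → Set
InΣ w = InA w × p (Z w) ≡ i2

Θ : {m : ℕ} .{{_ : NonZero m}} → Fin m → Fin m → Fin m × Fin m
Θ x z with does (z ≟ neg 1)
... | true = (x +m neg 1 , 0m)
... | false with does (x ≟ 0m) ∧ does (z ≟ 0m)
...   | true = (neg 1 , 0m)
...   | false = (x +m neg 2 , z +m 1m)

y′ : {m : ℕ} .{{_ : NonZero m}} → Fin m → Fin m → Fin m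
y′ y z = if does (z ≟ neg 1) then y else y +m 1m

-- p selects 2 only on zero-sets containing 3, and p never selects 3 while B ≠ 0.  So along the
-- orbit of Y the entry B never moves and the fourth entry grows by exactly 1 per step: it
-- vanishes only at the start and after m steps.  The first step therefore selects 4 (x ≠ 0) or
-- 1 (x = z = 0, where y = -B ≠ 0), and each of the m - 1 later steps selects 0, except the one
-- step at which the last entry passes through 0, which selects 1.  A step selecting 0 moves the
-- first entry by -2, one selecting 1 or 4 by -3; adding up these moves, and those of y and z,
-- modulo m gives Θ.
module Submission where

open import Defs
open import Data.Nat using (ℕ; zero; suc; _+_; _*_; _∸_; _<_; _≤_; NonZero; s≤s; z<s)
open import Data.Nat.Properties
  using (+-identityʳ; +-suc; +-assoc; +-comm; ≤-refl; ≤-reflexive; ≤-trans; <⇒≤; <⇒≢; ≤-pred;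
         ≤∧≢⇒<; m+[n∸m]≡n; m∸n≤m)
open import Data.Nat.DivMod
  using (_%_; m%n<n; m<n⇒m%n≡m; %-distribˡ-+; %-congˡ; [m+n]%n≡m%n; [m+kn]%n≡m%n)
open import Data.Nat.Tactic.RingSolver using (solve-∀)
open import Data.Fin using (Fin; toℕ; _≟_)
open import Data.Fin.Properties using (toℕ-fromℕ<; toℕ-injective; toℕ<n)
open import Data.Bool using (true; false)
open import Data.Vec using ([]; _∷_)
open import Data.Product using (_,_; proj₁; proj₂)
open import Data.Empty using (⊥-elim)
open import Function using (_∘_)
open import Relation.Binary.PropositionalEquality
open import Relation.Nullary using (¬_; Dec; yes; no)
open import Relation.Nullary.Decidable using (does; dec-true; dec-false)

iter-+ : ∀ {A : Set} m n (f : A → A) x → iter (m + n) f x ≡ iter m f (iter n f x)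
iter-+ zero    n f x = refl
iter-+ (suc m) n f x = cong f (iter-+ m n f x)

iter-suc : ∀ {A : Set} n (f : A → A) x → iter (suc n) f x ≡ iter n f (f x)
iter-suc n f x = trans (cong (λ k → iter k f x) (+-comm 1 n)) (iter-+ n 1 f x)

module _ {m : ℕ} .{{_ : NonZero m}} where

  toℕ-mod : ∀ n → toℕ (mod {m} n) ≡ n % m
  toℕ-mod n = toℕ-fromℕ< (m%n<n n m)

  mod-cong : ∀ {a b} → a % m ≡ b % m → mod {m} a ≡ mod b
  mod-cong {a} {b} eq = toℕ-injective (trans (toℕ-mod a) (trans eq (sym (toℕ-mod b))))

  mod-toℕ : ∀ (a : Fin m) → mod (toℕ a) ≡ a
  mod-toℕ a = toℕ-injective (trans (toℕ-mod (toℕ a)) (m<n⇒m%n≡m (toℕ<n a)))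

  mod-+ : ∀ a k → mod {m} a +m mod k ≡ mod (k + a)
  mod-+ a k = mod-cong (begin
    (toℕ (mod {m} a) + toℕ (mod {m} k)) % m ≡⟨ cong₂ (λ u v → (u + v) % m) (toℕ-mod a) (toℕ-mod k) ⟩
    (a % m + k % m) % m                    ≡⟨ %-distribˡ-+ a k m ⟨
    (a + k) % m                            ≡⟨ %-congˡ (+-comm a k) ⟩
    (k + a) % m                            ∎)
    where open ≡-Reasoning

  +m-mod : ∀ (a : Fin m) k → a +m mod k ≡ mod (k + toℕ a)
  +m-mod a k = trans (cong (_+m mod k) (sym (mod-toℕ a))) (mod-+ (toℕ a) k)

  +m-identityʳ : ∀ (a : Fin m) → a +m 0m ≡ a
  +m-identityʳ a = trans (+m-mod a 0) (mod-toℕ a)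

  +m-identityˡ : ∀ (a : Fin m) → 0m +m a ≡ a
  +m-identityˡ a = begin
    0m +m a                  ≡⟨ cong (0m +m_) (mod-toℕ a) ⟨
    mod 0 +m mod (toℕ a)     ≡⟨ mod-+ 0 (toℕ a) ⟩
    mod (toℕ a + 0)          ≡⟨ cong mod (+-identityʳ (toℕ a)) ⟩
    mod (toℕ a)              ≡⟨ mod-toℕ a ⟩
    a                        ∎
    where open ≡-Reasoning

  mod-+-self : ∀ a → mod {m} (a + m) ≡ mod a
  mod-+-self a = mod-cong ([m+n]%n≡m%n a m)

  mod-+-multiple : ∀ a k → mod {m} (a + k * m) ≡ mod a
  mod-+-multiple a k = mod-cong ([m+kn]%n≡m%n a k m)

  mod-toℕ-≢0m : ∀ {a : Fin m} → a ≢ 0m → mod (toℕ a) ≢ 0m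
  mod-toℕ-≢0m {a} a≢0 = a≢0 ∘ trans (sym (mod-toℕ a))

  mod≢0m : ∀ {n} → 0 < n → n < m → mod {m} n ≢ 0m
  mod≢0m {n} 0<n n<m eq = <⇒≢ 0<n (sym (begin
    n               ≡⟨ m<n⇒m%n≡m n<m ⟨
    n % m           ≡⟨ toℕ-mod n ⟨
    toℕ (mod {m} n) ≡⟨ cong toℕ eq ⟩
    toℕ (mod {m} 0) ≡⟨ toℕ-mod 0 ⟩
    0 % m           ≡⟨ m<n⇒m%n≡m (≤-trans 0<n (<⇒≤ n<m)) ⟩
    0               ∎))
    where open ≡-Reasoning

p-Z∩234≡∅ : ∀ {b₀ b₁ b₂ b₃ b₄} → b₂ ≡ false → b₃ ≡ false → b₄ ≡ false →
            p (b₀ ∷ b₁ ∷ b₂ ∷ b₃ ∷ b₄ ∷ []) ≡ i0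
p-Z∩234≡∅ {false} {false} refl refl refl = refl
p-Z∩234≡∅ {false} {true}  refl refl refl = refl
p-Z∩234≡∅ {true}  {false} refl refl refl = refl
p-Z∩234≡∅ {true}  {true}  refl refl refl = refl

p-Z∩234≡4 : ∀ {b₀ b₁ b₂ b₃ b₄} → b₂ ≡ false → b₃ ≡ false → b₄ ≡ true →
            p (b₀ ∷ b₁ ∷ b₂ ∷ b₃ ∷ b₄ ∷ []) ≡ i1
p-Z∩234≡4 {false} {false} refl refl refl = refl
p-Z∩234≡4 {false} {true}  refl refl refl = refl
p-Z∩234≡4 {true}  {false} refl refl refl = refl
p-Z∩234≡4 {true}  {true}  refl refl refl = refl

p-Z≡034 : ∀ {b₀ b₁ b₂ b₃ b₄} → b₀ ≡ true → b₁ ≡ false → b₂ ≡ false → b₃ ≡ true → b₄ ≡ true →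
          p (b₀ ∷ b₁ ∷ b₂ ∷ b₃ ∷ b₄ ∷ []) ≡ i1
p-Z≡034 refl refl refl refl refl = refl

p-Z∩023≡3 : ∀ {b₀ b₁ b₂ b₃ b₄} → b₀ ≡ false → b₂ ≡ false → b₃ ≡ true →
            p (b₀ ∷ b₁ ∷ b₂ ∷ b₃ ∷ b₄ ∷ []) ≡ i4
p-Z∩023≡3 {b₁ = false} {b₄ = false} refl refl refl = refl
p-Z∩023≡3 {b₁ = false} {b₄ = true}  refl refl refl = refl
p-Z∩023≡3 {b₁ = true}  {b₄ = false} refl refl refl = refl
p-Z∩023≡3 {b₁ = true}  {b₄ = true}  refl refl refl = refl

p-Z∩0234≡03 : ∀ {b₀ b₁ b₂ b₃ b₄} → b₀ ≡ true → b₂ ≡ false → b₃ ≡ true → b₄ ≡ false →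
              p (b₀ ∷ b₁ ∷ b₂ ∷ b₃ ∷ b₄ ∷ []) ≡ i2
p-Z∩0234≡03 {b₁ = false} refl refl refl refl = refl
p-Z∩0234≡03 {b₁ = true}  refl refl refl refl = refl

module _ {m : ℕ} .{{_ : NonZero m}} {z : Fin m} where

  Θ-at-neg1 : ∀ x → z ≡ neg 1 → Θ x z ≡ (x +m neg 1 , 0m)
  Θ-at-neg1 x z≡-1 with z ≟ neg 1
  ... | yes _    = refl
  ... | no z≢-1  = ⊥-elim (z≢-1 z≡-1)

  Θ-at-origin : ∀ x → z ≢ neg 1 → x ≡ 0m → z ≡ 0m → Θ x z ≡ (neg 1 , 0m)
  Θ-at-origin x z≢-1 x≡0 z≡0 with z ≟ neg 1
  ... | yes z≡-1 = ⊥-elim (z≢-1 z≡-1)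
  ... | no _ with x ≟ 0m | z ≟ 0m
  ...   | yes _   | yes _   = refl
  ...   | no x≢0  | _       = ⊥-elim (x≢0 x≡0)
  ...   | yes _   | no z≢0  = ⊥-elim (z≢0 z≡0)

  Θ-generic : ∀ x → z ≢ neg 1 → x ≢ 0m → Θ x z ≡ (x +m neg 2 , z +m 1m)
  Θ-generic x z≢-1 x≢0 with z ≟ neg 1
  ... | yes z≡-1 = ⊥-elim (z≢-1 z≡-1)
  ... | no _ with x ≟ 0m
  ...   | yes x≡0 = ⊥-elim (x≢0 x≡0)
  ...   | no _    = refl

  y′-at-neg1 : ∀ y → z ≡ neg 1 → y′ y z ≡ y
  y′-at-neg1 y z≡-1 with z ≟ neg 1
  ... | yes _   = refl
  ... | no z≢-1 = ⊥-elim (z≢-1 z≡-1)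

  y′-generic : ∀ y → z ≢ neg 1 → y′ y z ≡ y +m 1m
  y′-generic y z≢-1 with z ≟ neg 1
  ... | yes z≡-1 = ⊥-elim (z≢-1 z≡-1)
  ... | no _     = refl

[4+r][3+r]+a≡2+a+[2+r][5+r] : ∀ a r → (4 + r) * (3 + r) + a ≡ 2 + a + (2 + r) * (5 + r)
[4+r][3+r]+a≡2+a+[2+r][5+r] = solve-∀

d[3+r]+[2+r+[k[3+r]+a]]≡[d+k][3+r]+[2+r]+a : ∀ a d k r →
  d * (3 + r) + (2 + r + (k * (3 + r) + a)) ≡ (d + k) * (3 + r) + (2 + r) + a
d[3+r]+[2+r+[k[3+r]+a]]≡[d+k][3+r]+[2+r]+a = solve-∀

[3+r][3+r]+[2+r]+a≡1+a+[2+r][5+r] : ∀ a r → (3 + r) * (3 + r) + (2 + r) + a ≡ 1 + a + (2 + r) * (5 + r)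
[3+r][3+r]+[2+r]+a≡1+a+[2+r][5+r] = solve-∀

-- With m = 5 + r the constants -3, -2, -1 in G and Θ are definitionally mod (2 + r),
-- mod (3 + r), mod (4 + r), so G can be computed on natural representatives.
module Orbit (r : ℕ) {B : Fin (5 + r)} (B≢0 : B ≢ 0m) where

  M : ℕ
  M = 5 + r

  -- c is the fourth entry, the one that is 0 in the statement.
  ⟨_,_,_,_⟩ : ℕ → ℕ → ℕ → ℕ → Pt M
  ⟨ a , b , c , d ⟩ = mod a ∷ mod b ∷ B ∷ mod c ∷ mod d ∷ []

  ⟦_,_,_⟧ : Fin M → Fin M → Fin M → Pt M
  ⟦ x , y , z ⟧ = x ∷ y ∷ B ∷ 0m ∷ z ∷ []

  -- Stated via cong on the count: checking iter-suc directly against iter M makes Agda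
  -- unfold both iterates of G.
  iter-M : ∀ (w : Pt M) → iter M G w ≡ iter (4 + r) G (G w)
  iter-M w = trans (cong (λ n → iter n G w) {M} {suc (4 + r)} refl) (iter-suc (4 + r) G w)

  point-cong : ∀ {u₀ u₁ u₃ u₄ v₀ v₁ v₃ v₄ : Fin M} → u₀ ≡ v₀ → u₁ ≡ v₁ → u₃ ≡ v₃ → u₄ ≡ v₄ →
            (u₀ ∷ u₁ ∷ B ∷ u₃ ∷ u₄ ∷ []) ≡ (v₀ ∷ v₁ ∷ B ∷ v₃ ∷ v₄ ∷ [])
  point-cong refl refl refl refl = refl

  point≡⟨toℕ⟩ : ∀ x y z → ⟦ x , y , z ⟧ ≡ ⟨ toℕ x , toℕ y , 0 , toℕ z ⟩
  point≡⟨toℕ⟩ x y z = point-cong (sym (mod-toℕ x)) (sym (mod-toℕ y)) refl (sym (mod-toℕ z))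

  -- Translations are added on the left, so that consecutive steps compose definitionally:
  -- 1 + (2 + r + a) is 3 + r + a.
  ⟨⟩-translate : ∀ a b c d k₀ k₁ k₃ k₄ l₀ l₁ l₃ l₄ →
    (⟨ a , b , c , d ⟩ ⊕ (mod k₀ ∷ mod k₁ ∷ 0m ∷ mod k₃ ∷ mod k₄ ∷ []))
                       ⊕ (mod l₀ ∷ mod l₁ ∷ 0m ∷ mod l₃ ∷ mod l₄ ∷ [])
      ≡ ⟨ l₀ + (k₀ + a) , l₁ + (k₁ + b) , l₃ + (k₃ + c) , l₄ + (k₄ + d) ⟩
  ⟨⟩-translate a b c d k₀ k₁ k₃ k₄ l₀ l₁ l₃ l₄ =
    cong₂ _∷_ (translate a k₀ l₀) (cong₂ _∷_ (translate b k₁ l₁) (cong₂ _∷_ B+0+0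
      (cong₂ _∷_ (translate c k₃ l₃) (cong (_∷ []) (translate d k₄ l₄)))))
    where
    translate : ∀ u k l → (mod {M} u +m mod k) +m mod l ≡ mod (l + (k + u))
    translate u k l = trans (cong (_+m mod l) (mod-+ {M} u k)) (mod-+ {M} (k + u) l)
    B+0+0 : (B +m 0m) +m 0m ≡ B
    B+0+0 = trans (+m-identityʳ (B +m 0m)) (+m-identityʳ B)

  G-selecting : ∀ (w : Pt M) {i} → p (Z w) ≡ i → G w ≡ (w ⊕ shiftG) ⊕ e i
  G-selecting w = cong (λ i → (w ⊕ shiftG) ⊕ e i)

  B≢0ᵇ : does (B ≟ 0m) ≡ false
  B≢0ᵇ = dec-false (B ≟ 0m) B≢0

  G-step : ∀ a b c d → mod c ≢ 0m → mod d ≢ 0m → G ⟨ a , b , c , d ⟩ ≡ ⟨ 3 + r + a , b , suc c , suc d ⟩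
  G-step a b c d c≢0 d≢0 = trans
    (G-selecting ⟨ a , b , c , d ⟩
      (p-Z∩234≡∅ B≢0ᵇ (dec-false (mod c ≟ 0m) c≢0) (dec-false (mod d ≟ 0m) d≢0)))
    (⟨⟩-translate a b c d (2 + r) 0 1 1 1 0 0 0)

  G-step-at-d≡0 : ∀ a b c → mod c ≢ 0m → G ⟨ a , b , c , 0 ⟩ ≡ ⟨ 2 + r + a , suc b , suc c , 1 ⟩
  G-step-at-d≡0 a b c c≢0 = trans
    (G-selecting ⟨ a , b , c , 0 ⟩ (p-Z∩234≡4 B≢0ᵇ (dec-false (mod c ≟ 0m) c≢0) refl))
    (⟨⟩-translate a b c 0 (2 + r) 0 1 1 0 1 0 0)

  G-step-at-c≡0 : ∀ a b d → mod a ≢ 0m → G ⟨ a , b , 0 , d ⟩ ≡ ⟨ 2 + r + a , b , 1 , 2 + d ⟩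
  G-step-at-c≡0 a b d a≢0 = trans
    (G-selecting ⟨ a , b , 0 , d ⟩ (p-Z∩023≡3 (dec-false (mod a ≟ 0m) a≢0) B≢0ᵇ refl))
    (⟨⟩-translate a b 0 d (2 + r) 0 1 1 0 0 0 1)

  G-step-at-a≡c≡d≡0 : ∀ b → mod b ≢ 0m → G ⟨ 0 , b , 0 , 0 ⟩ ≡ ⟨ 2 + r + 0 , suc b , 1 , 1 ⟩
  G-step-at-a≡c≡d≡0 b b≢0 = trans
    (G-selecting ⟨ 0 , b , 0 , 0 ⟩ (p-Z≡034 refl (dec-false (mod b ≟ 0m) b≢0) B≢0ᵇ refl refl))
    (⟨⟩-translate 0 b 0 0 (2 + r) 0 1 1 0 1 0 0)

  drift : ∀ k a b c d → suc c + k ≤ M → suc d + k ≤ M →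
          iter k G ⟨ a , b , suc c , suc d ⟩ ≡ ⟨ k * (3 + r) + a , b , suc c + k , suc d + k ⟩
  drift zero a b c d _ _ =
    point-cong refl refl (cong mod (sym (+-identityʳ (suc c)))) (cong mod (sym (+-identityʳ (suc d))))
  drift (suc k) a b c d c+k≤M d+k≤M = begin
    G (iter k G ⟨ a , b , suc c , suc d ⟩)
      ≡⟨ cong G (drift k a b c d (<⇒≤ c+k<M) (<⇒≤ d+k<M)) ⟩
    G ⟨ k * (3 + r) + a , b , suc c + k , suc d + k ⟩
      ≡⟨ G-step (k * (3 + r) + a) b (suc c + k) (suc d + k) (mod≢0m z<s c+k<M) (mod≢0m z<s d+k<M) ⟩
    ⟨ 3 + r + (k * (3 + r) + a) , b , suc (suc c + k) , suc (suc d + k) ⟩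
      ≡⟨ point-cong (cong mod (sym (+-assoc (3 + r) (k * (3 + r)) a))) refl
                 (cong mod (sym (+-suc (suc c) k))) (cong mod (sym (+-suc (suc d) k))) ⟩
    ⟨ suc k * (3 + r) + a , b , suc c + suc k , suc d + suc k ⟩ ∎
    where
    open ≡-Reasoning
    c+k<M : suc c + k < M
    c+k<M = ≤-trans (≤-reflexive (sym (+-suc (suc c) k))) c+k≤M
    d+k<M : suc d + k < M
    d+k<M = ≤-trans (≤-reflexive (sym (+-suc (suc d) k))) d+k≤M

  sweep-avoiding-0 : ∀ a b → iter (4 + r) G ⟨ a , b , 1 , 1 ⟩ ≡ ⟨ 2 + a , b , 0 , 0 ⟩
  sweep-avoiding-0 a b = begin
    iter (4 + r) G ⟨ a , b , 1 , 1 ⟩       ≡⟨ drift (4 + r) a b 0 0 ≤-refl ≤-refl ⟩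
    ⟨ (4 + r) * (3 + r) + a , b , M , M ⟩  ≡⟨ point-cong a-shift refl (mod-+-self 0) (mod-+-self 0) ⟩
    ⟨ 2 + a , b , 0 , 0 ⟩                  ∎
    where
    open ≡-Reasoning
    a-shift : mod {M} ((4 + r) * (3 + r) + a) ≡ mod (2 + a)
    a-shift = trans (cong mod ([4+r][3+r]+a≡2+a+[2+r][5+r] a r)) (mod-+-multiple (2 + a) (2 + r))

  sweep-through-0 : ∀ a b d → d ≤ 3 + r →
                    iter (4 + r) G ⟨ a , b , 1 , 2 + d ⟩ ≡ ⟨ 1 + a , suc b , 0 , 1 + d ⟩
  sweep-through-0 a b d d≤3+r = begin
    iter (4 + r) G ⟨ a , b , 1 , 2 + d ⟩
      ≡⟨ cong (λ n → iter n G ⟨ a , b , 1 , 2 + d ⟩) 4+r≡d+1+k ⟩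
    iter (d + suc k) G ⟨ a , b , 1 , 2 + d ⟩
      ≡⟨ iter-+ d (suc k) G _ ⟩
    iter d G (G (iter k G ⟨ a , b , 1 , 2 + d ⟩))
      ≡⟨ cong (iter d G) (cong G (drift k a b 0 (suc d) (<⇒≤ 1+k<M) (≤-reflexive 2+d+k≡M))) ⟩
    iter d G (G ⟨ k * (3 + r) + a , b , suc k , 2 + d + k ⟩)
      ≡⟨ cong (iter d G) (cong G d-wraps) ⟩
    iter d G (G ⟨ k * (3 + r) + a , b , suc k , 0 ⟩)
      ≡⟨ cong (iter d G) (G-step-at-d≡0 (k * (3 + r) + a) b (suc k) (mod≢0m z<s 1+k<M)) ⟩
    iter d G ⟨ 2 + r + (k * (3 + r) + a) , suc b , 2 + k , 1 ⟩
      ≡⟨ drift d (2 + r + (k * (3 + r) + a)) (suc b) (suc k) 0 (≤-reflexive 2+k+d≡M) 1+d≤M ⟩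
    ⟨ d * (3 + r) + (2 + r + (k * (3 + r) + a)) , suc b , 2 + k + d , 1 + d ⟩
      ≡⟨ point-cong a-shift refl (trans (cong mod 2+k+d≡M) (mod-+-self 0)) refl ⟩
    ⟨ 1 + a , suc b , 0 , 1 + d ⟩
      ∎
    where
    open ≡-Reasoning
    k : ℕ
    k = 3 + r ∸ d
    d+k≡3+r : d + k ≡ 3 + r
    d+k≡3+r = m+[n∸m]≡n d≤3+r
    k≤3+r : k ≤ 3 + r
    k≤3+r = m∸n≤m (3 + r) d
    1+k<M : suc k < M
    1+k<M = s≤s (s≤s k≤3+r)
    1+d≤M : suc d ≤ M
    1+d≤M = <⇒≤ (s≤s (s≤s d≤3+r))
    4+r≡d+1+k : 4 + r ≡ d + suc k
    4+r≡d+1+k = trans (cong suc (sym d+k≡3+r)) (sym (+-suc d k))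
    2+d+k≡M : 2 + d + k ≡ M
    2+d+k≡M = cong (2 +_) d+k≡3+r
    d-wraps : ⟨ k * (3 + r) + a , b , suc k , 2 + d + k ⟩ ≡ ⟨ k * (3 + r) + a , b , suc k , 0 ⟩
    d-wraps = point-cong refl refl refl (trans (cong mod 2+d+k≡M) (mod-+-self 0))
    2+k+d≡M : 2 + k + d ≡ M
    2+k+d≡M = cong (2 +_) (trans (+-comm k d) d+k≡3+r)
    a-shift : mod {M} (d * (3 + r) + (2 + r + (k * (3 + r) + a))) ≡ mod (1 + a)
    a-shift = begin
      mod (d * (3 + r) + (2 + r + (k * (3 + r) + a)))
        ≡⟨ cong mod (d[3+r]+[2+r+[k[3+r]+a]]≡[d+k][3+r]+[2+r]+a a d k r) ⟩
      mod ((d + k) * (3 + r) + (2 + r) + a)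
        ≡⟨ cong (λ n → mod (n * (3 + r) + (2 + r) + a)) d+k≡3+r ⟩
      mod ((3 + r) * (3 + r) + (2 + r) + a)
        ≡⟨ cong mod ([3+r][3+r]+[2+r]+a≡1+a+[2+r][5+r] a r) ⟩
      mod (1 + a + (2 + r) * (5 + r))
        ≡⟨ mod-+-multiple (1 + a) (2 + r) ⟩
      mod (1 + a)
        ∎

  toℕ≤3+r : ∀ (z : Fin M) → z ≢ neg 1 → toℕ z ≤ 3 + r
  toℕ≤3+r z z≢-1 = ≤-pred (≤∧≢⇒< (≤-pred (toℕ<n z)) toℕ≢4+r)
    where
    toℕ≢4+r : toℕ z ≢ 4 + r
    toℕ≢4+r eq = z≢-1 (trans (sym (mod-toℕ z)) (cong mod eq))

  orbit-generic : ∀ {x z} y → x ≢ 0m → z ≢ neg 1 →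
                  iter M G ⟦ x , y , z ⟧ ≡ ⟦ x +m neg 2 , y +m 1m , z +m 1m ⟧
  orbit-generic {x} {z} y x≢0 z≢-1 = begin
    iter M G ⟦ x , y , z ⟧
      ≡⟨ iter-M ⟦ x , y , z ⟧ ⟩
    iter (4 + r) G (G ⟦ x , y , z ⟧)
      ≡⟨ cong (iter (4 + r) G) (cong G (point≡⟨toℕ⟩ x y z)) ⟩
    iter (4 + r) G (G ⟨ toℕ x , toℕ y , 0 , toℕ z ⟩)
      ≡⟨ cong (iter (4 + r) G) (G-step-at-c≡0 (toℕ x) (toℕ y) (toℕ z) (mod-toℕ-≢0m x≢0)) ⟩
    iter (4 + r) G ⟨ 2 + r + toℕ x , toℕ y , 1 , 2 + toℕ z ⟩
      ≡⟨ sweep-through-0 (2 + r + toℕ x) (toℕ y) (toℕ z) (toℕ≤3+r z z≢-1) ⟩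
    ⟨ 3 + r + toℕ x , suc (toℕ y) , 0 , 1 + toℕ z ⟩
      ≡⟨ point-cong (+m-mod x (3 + r)) (+m-mod y 1) refl (+m-mod z 1) ⟨
    ⟦ x +m neg 2 , y +m 1m , z +m 1m ⟧
      ∎
    where open ≡-Reasoning

  orbit-at-neg1 : ∀ {x z} y → z ≡ neg 1 → x ≢ 0m →
                  iter M G ⟦ x , y , z ⟧ ≡ ⟦ x +m neg 1 , y , 0m ⟧
  orbit-at-neg1 {x} y refl x≢0 = begin
    iter M G ⟦ x , y , neg 1 ⟧
      ≡⟨ iter-M ⟦ x , y , neg 1 ⟧ ⟩
    iter (4 + r) G (G ⟦ x , y , neg 1 ⟧)
      ≡⟨ cong (iter (4 + r) G) (cong G start) ⟩
    iter (4 + r) G (G ⟨ toℕ x , toℕ y , 0 , 4 + r ⟩)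
      ≡⟨ cong (iter (4 + r) G) (G-step-at-c≡0 (toℕ x) (toℕ y) (4 + r) (mod-toℕ-≢0m x≢0)) ⟩
    iter (4 + r) G ⟨ 2 + r + toℕ x , toℕ y , 1 , 1 + M ⟩
      ≡⟨ cong (iter (4 + r) G) d-wraps ⟩
    iter (4 + r) G ⟨ 2 + r + toℕ x , toℕ y , 1 , 1 ⟩
      ≡⟨ sweep-avoiding-0 (2 + r + toℕ x) (toℕ y) ⟩
    ⟨ 4 + r + toℕ x , toℕ y , 0 , 0 ⟩
      ≡⟨ point-cong (+m-mod x (4 + r)) (sym (mod-toℕ y)) refl refl ⟨
    ⟦ x +m neg 1 , y , 0m ⟧
      ∎
    where
    open ≡-Reasoning
    start : ⟦ x , y , neg 1 ⟧ ≡ ⟨ toℕ x , toℕ y , 0 , 4 + r ⟩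
    start = point-cong (sym (mod-toℕ x)) (sym (mod-toℕ y)) refl refl
    d-wraps : ⟨ 2 + r + toℕ x , toℕ y , 1 , 1 + M ⟩ ≡ ⟨ 2 + r + toℕ x , toℕ y , 1 , 1 ⟩
    d-wraps = point-cong refl refl refl (mod-+-self 1)

  orbit-at-origin : ∀ {x y z} → x ≡ 0m → z ≡ 0m → y ≢ 0m →
                    iter M G ⟦ x , y , z ⟧ ≡ ⟦ neg 1 , y +m 1m , 0m ⟧
  orbit-at-origin {x} {y} {z} x≡0 z≡0 y≢0 = begin
    iter M G ⟦ x , y , z ⟧
      ≡⟨ cong₂ (λ x z → iter M G ⟦ x , y , z ⟧) x≡0 z≡0 ⟩
    iter M G ⟦ 0m , y , 0m ⟧
      ≡⟨ iter-M ⟦ 0m , y , 0m ⟧ ⟩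
    iter (4 + r) G (G ⟦ 0m , y , 0m ⟧)
      ≡⟨ cong (iter (4 + r) G) (cong G start) ⟩
    iter (4 + r) G (G ⟨ 0 , toℕ y , 0 , 0 ⟩)
      ≡⟨ cong (iter (4 + r) G) (G-step-at-a≡c≡d≡0 (toℕ y) (mod-toℕ-≢0m y≢0)) ⟩
    iter (4 + r) G ⟨ 2 + r + 0 , suc (toℕ y) , 1 , 1 ⟩
      ≡⟨ sweep-avoiding-0 (2 + r + 0) (suc (toℕ y)) ⟩
    ⟨ 4 + r + 0 , suc (toℕ y) , 0 , 0 ⟩
      ≡⟨ point-cong (cong mod (+-identityʳ (4 + r))) (sym (+m-mod y 1)) refl refl ⟩
    ⟦ neg 1 , y +m 1m , 0m ⟧
      ∎
    where
    open ≡-Reasoning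
    start : ⟦ 0m , y , 0m ⟧ ≡ ⟨ 0 , toℕ y , 0 , 0 ⟩
    start = point≡⟨toℕ⟩ 0m y 0m

  neg1≢0m : neg {M} 1 ≢ 0m
  neg1≢0m = mod≢0m z<s ≤-refl

  p-Z≡i2 : ∀ {x z} y → x ≡ 0m → z ≢ 0m → p (Z ⟦ x , y , z ⟧) ≡ i2
  p-Z≡i2 {x} {z} y x≡0 z≢0 = p-Z∩0234≡03 (dec-true (x ≟ 0m) x≡0) B≢0ᵇ refl (dec-false (z ≟ 0m) z≢0)

  y≢0-at-origin : ∀ {x y z} → x ≡ 0m → z ≡ 0m → InA ⟦ x , y , z ⟧ → y ≢ 0m
  y≢0-at-origin refl refl sum≡0 refl = B≢0 (trans (sym sum≡B) sum≡0)
    where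
    sum≡B : sum5 ⟦ 0m , 0m , 0m ⟧ ≡ B
    sum≡B = trans (+m-identityˡ _) (trans (+m-identityˡ _)
              (trans (cong (B +m_) (+m-identityʳ 0m)) (+m-identityʳ B)))

  Θ-image : Fin M → Fin M → Fin M → Pt M
  Θ-image x y z = ⟦ proj₁ (Θ x z) , y′ y z , proj₂ (Θ x z) ⟧

  Θ-image-≡ : ∀ x y z {x′ y″ z′} → Θ x z ≡ (x′ , z′) → y′ y z ≡ y″ → Θ-image x y z ≡ ⟦ x′ , y″ , z′ ⟧
  Θ-image-≡ x y z Θ≡ y′≡ = cong₂ (λ θ v → ⟦ proj₁ θ , v , proj₂ θ ⟧) Θ≡ y′≡

  orbit : ∀ x y z → InA ⟦ x , y , z ⟧ → ¬ InΣ ⟦ x , y , z ⟧ → iter M G ⟦ x , y , z ⟧ ≡ Θ-image x y z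
  orbit x y z inA ∉Σ = by-cases (z ≟ neg 1) (x ≟ 0m) (z ≟ 0m)
    where
    by-cases : Dec (z ≡ neg 1) → Dec (x ≡ 0m) → Dec (z ≡ 0m) → iter M G ⟦ x , y , z ⟧ ≡ Θ-image x y z
    by-cases (yes z≡-1) (yes x≡0) _ = ⊥-elim (∉Σ (inA , p-Z≡i2 y x≡0 (neg1≢0m ∘ trans (sym z≡-1))))
    by-cases (yes z≡-1) (no x≢0)  _ =
      trans (orbit-at-neg1 y z≡-1 x≢0) (sym (Θ-image-≡ x y z (Θ-at-neg1 x z≡-1) (y′-at-neg1 y z≡-1)))
    by-cases (no z≢-1)  (no x≢0)  _ =
      trans (orbit-generic y x≢0 z≢-1) (sym (Θ-image-≡ x y z (Θ-generic x z≢-1 x≢0) (y′-generic y z≢-1)))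
    by-cases (no z≢-1)  (yes x≡0) (no z≢0) = ⊥-elim (∉Σ (inA , p-Z≡i2 y x≡0 z≢0))
    by-cases (no z≢-1)  (yes x≡0) (yes z≡0) =
      trans (orbit-at-origin x≡0 z≡0 (y≢0-at-origin x≡0 z≡0 inA))
            (sym (Θ-image-≡ x y z (Θ-at-origin x z≢-1 x≡0 z≡0) (y′-generic y z≢-1)))

mainTheorem7 : (m : ℕ) → .{{_ : NonZero m}} → 5 ≤ m → m % 2 ≡ 1 →
    (x y B z : Fin m) →
    InA (x ∷ y ∷ B ∷ 0m ∷ z ∷ []) →
    ¬ (B ≡ 0m) →
    ¬ InΣ (x ∷ y ∷ B ∷ 0m ∷ z ∷ []) →
    iter m G (x ∷ y ∷ B ∷ 0m ∷ z ∷ [])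
      ≡ (proj₁ (Θ x z) ∷ y′ y z ∷ B ∷ 0m ∷ proj₂ (Θ x z) ∷ [])
mainTheorem7 _ (s≤s (s≤s (s≤s (s≤s (s≤s {n = r} _))))) _ x y B z inA B≢0 ∉Σ =
  Orbit.orbit r B≢0 x y z inA ∉Σ
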